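{- Let $n,m$ be positive integers with $n/m\le 60$, let $b=m$ and $\rho=1.6$. Then Algorithm Bricks on input $(n,m,b,\rho)$ outputs bag sizes $a_1,\dots,a_b$ with $\sum_{j=1}^b a_j\ge n$.
   Context: Algorithm Bricks (input: number of unit-size jobs $n$, number of machines $m$, number of bags $b$, desired robustness factor $\rho$): set $c\gets n$; for $j=1,\dots,b$: set $z\gets\lceil c/m\rceil$, $a_j\gets\lfloor z\rho\rfloor$, $c\gets c-z$. Return $a_1,\dots,a_b$. (The number $z$ is called the cost of bag $j$.) -}

module Defs where

open import Data.Nat using (ℕ; zero; suc; _+_; _*_; _∸_; NonZero)
open import Data.Nat.DivMod using (_/_)
open import Data.List using (List; []; _∷_)

⌈_/_⌉ : ℕ → (m : ℕ) → .{{NonZero m}} → ℕ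
⌈ c / m ⌉ = (c + (m ∸ 1)) / m

-- Algorithm Bricks with a rational robustness factor ρ = p / q (q > 0).
-- bricksFrom m p q c k : the bags produced by k remaining iterations
-- starting with remaining count c.
bricksFrom : (m : ℕ) → .{{NonZero m}} → (p q : ℕ) → .{{NonZero q}} →
             (c : ℕ) → (k : ℕ) → List ℕ
bricksFrom m p q c zero = []
bricksFrom m p q c (suc k) =
  let z = ⌈ c / m ⌉ in ((z * p) / q) ∷ bricksFrom m p q (c ∸ z) k

bricks : (n m : ℕ) → .{{NonZero m}} → (b p q : ℕ) → .{{NonZero q}} → List ℕ
bricks n m b p q = bricksFrom m p q n b

-- When c jobs remain, the next bag costs z = ⌈c/m⌉ and receives ⌊8z/5⌋ = z + bonus z
-- jobs.  The costs add up to n minus the final remainder r, so it suffices that the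
-- bonuses add up to at least r.  Take multipliers D, M and antitone weights s with
-- M ≤ D · bonus z + z · s z for every cost z ≤ 60.  The potential
-- Φ c = Σ_{y ≤ c} s ⌈y/m⌉ then loses at least z · s z when c drops by z, so after the m
-- rounds D · Σ bonus ≥ M · m + Φ r − Φ n.  Φ is explicit on blocks of m consecutive
-- integers, and D · r ≤ D · Σ bonus becomes a combination of two linear "budget"
-- inequalities, weighted by the position of r inside its block.  For each value of
-- ⌈r/m⌉ the multipliers in 'levels', with the least admissible weights, satisfy both
-- budgets; this is checked by evaluation.

module Submission where

open import Defs
open import Data.Nat using (ℕ; _*_; _≤_; NonZero)
open import Data.Nat.ListAction using (sum)
open import Data.Nat
  using (zero; suc; _+_; _∸_; _<_; _⊔_; _≤?_; z≤n; s≤s; _≤′_; ≤′-refl; ≤′-step;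
         >-nonZero)
open import Data.Nat.Properties
open import Data.Nat.DivMod
  using (_/_; _%_; m≡m%n+[m/n]*n; m%n<n; m*n/n≡m; /-monoˡ-≤; m<n*o⇒m/o<n)
open import Data.Nat.Tactic.RingSolver using (solve-∀)
open import Data.Product using (_×_; _,_; proj₁; proj₂)
open import Data.Fin using (toℕ; fromℕ<)
open import Data.Fin.Properties using (all?; toℕ-fromℕ<)
open import Data.Vec using (Vec; lookup; []; _∷_)
open import Function using (_∘_)
open import Relation.Nullary.Decidable using (Dec; _×-dec_; toWitness)
open import Relation.Binary.PropositionalEquality
  using (_≡_; refl; sym; trans; cong; cong₂; subst; module ≡-Reasoning)

module _ {n : ℕ} .{{_ : NonZero n}} where

  ⌈/⌉-monoˡ-≤ : ∀ {m o} → m ≤ o → ⌈ m / n ⌉ ≤ ⌈ o / n ⌉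
  ⌈/⌉-monoˡ-≤ m≤o = /-monoˡ-≤ n (+-monoˡ-≤ (n ∸ 1) m≤o)

  m*n<o⇒m<⌈o/n⌉ : ∀ {m o} → m * n < o → m < ⌈ o / n ⌉
  m*n<o⇒m<⌈o/n⌉ {m} {o} m*n<o = begin
      suc m                  ≡⟨ m*n/n≡m (suc m) n ⟨
      suc m * n / n          ≤⟨ /-monoˡ-≤ n bound ⟩
      ⌈ o / n ⌉              ∎
    where
    open ≤-Reasoning
    bound : suc m * n ≤ o + (n ∸ 1)
    bound = begin
      n + m * n              ≡⟨ cong (_+ m * n) (suc-pred n) ⟨
      suc (n ∸ 1 + m * n)    ≡⟨ +-suc (n ∸ 1) (m * n) ⟨
      n ∸ 1 + suc (m * n)    ≤⟨ +-monoʳ-≤ (n ∸ 1) m*n<o ⟩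
      n ∸ 1 + o              ≡⟨ +-comm (n ∸ 1) o ⟩
      o + (n ∸ 1)            ∎

  m≤o*n⇒⌈m/n⌉≤o : ∀ {m o} → m ≤ o * n → ⌈ m / n ⌉ ≤ o
  m≤o*n⇒⌈m/n⌉≤o {m} {o} m≤o*n = m<1+n⇒m≤n (m<n*o⇒m/o<n bound)
    where
    open ≤-Reasoning
    bound : m + (n ∸ 1) < suc o * n
    bound = begin-strict
      m + (n ∸ 1)            <⟨ +-monoʳ-< m (≤-reflexive (suc-pred n)) ⟩
      m + n                  ≤⟨ +-monoˡ-≤ n m≤o*n ⟩
      o * n + n              ≡⟨ +-comm (o * n) n ⟩
      suc o * n              ∎

  m≤⌈m/n⌉*n : ∀ m → m ≤ ⌈ m / n ⌉ * n
  m≤⌈m/n⌉*n m = ≮⇒≥ (λ lt → n≮n _ (m*n<o⇒m<⌈o/n⌉ lt))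

  ⌈m/n⌉≤m : ∀ m → ⌈ m / n ⌉ ≤ m
  ⌈m/n⌉≤m m = m≤o*n⇒⌈m/n⌉≤o (m≤m*n m n)

  o*n<m≤[1+o]*n⇒⌈m/n⌉≡1+o : ∀ {m o} → o * n < m → m ≤ suc o * n → ⌈ m / n ⌉ ≡ suc o
  o*n<m≤[1+o]*n⇒⌈m/n⌉≡1+o lo hi = ≤-antisym (m≤o*n⇒⌈m/n⌉≤o hi) (m*n<o⇒m<⌈o/n⌉ lo)

+-telescope-≤ : ∀ {a b c d x y z} → a + x ≤ b + y → c + y ≤ d + z → (c + a) + x ≤ (d + b) + z
+-telescope-≤ {a} {b} {c} {d} {x} {y} {z} ax≤by cy≤dz = begin
    (c + a) + x            ≡⟨ +-assoc c a x ⟩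
    c + (a + x)            ≤⟨ +-monoʳ-≤ c ax≤by ⟩
    c + (b + y)            ≡⟨ shuffle c b y ⟩
    b + (c + y)            ≤⟨ +-monoʳ-≤ b cy≤dz ⟩
    b + (d + z)            ≡⟨ shuffle b d z ⟩
    d + (b + z)            ≡⟨ +-assoc d b z ⟨
    (d + b) + z            ∎
  where
  open ≤-Reasoning
  shuffle : ∀ u v w → u + (v + w) ≡ v + (u + w)
  shuffle = solve-∀

prefixSum : (ℕ → ℕ) → ℕ → ℕ
prefixSum f zero    = 0
prefixSum f (suc x) = f (suc x) + prefixSum f x

prefixSum-mono-≤ : ∀ f {a b} → a ≤ b → prefixSum f a ≤ prefixSum f b
prefixSum-mono-≤ f a≤b = go (≤⇒≤′ a≤b)
  where
  go : ∀ {a b} → a ≤′ b → prefixSum f a ≤ prefixSum f b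
  go ≤′-refl         = ≤-refl
  go (≤′-step a≤′b) = ≤-trans (go a≤′b) (m≤n+m _ _)

prefixSum-constant : ∀ f {σ} a t → (∀ y → a < y → y ≤ t + a → f y ≡ σ) →
                     prefixSum f (t + a) ≡ t * σ + prefixSum f a
prefixSum-constant f a zero    _   = refl
prefixSum-constant f {σ} a (suc t) f≡σ = begin
    f (suc (t + a)) + prefixSum f (t + a)
      ≡⟨ cong₂ _+_ (f≡σ _ (s≤s (m≤n+m a t)) ≤-refl)
                   (prefixSum-constant f a t (λ y a<y y≤ → f≡σ y a<y (m≤n⇒m≤1+n y≤))) ⟩
    σ + (t * σ + prefixSum f a)
      ≡⟨ +-assoc σ (t * σ) _ ⟨
    suc t * σ + prefixSum f a ∎
  where open ≡-Reasoning

prefixSum-lower : ∀ f {σ} a t → (∀ y → a < y → y ≤ t + a → σ ≤ f y) →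
                  t * σ + prefixSum f a ≤ prefixSum f (t + a)
prefixSum-lower f a zero    _   = ≤-refl
prefixSum-lower f {σ} a (suc t) σ≤f = begin
    suc t * σ + prefixSum f a
      ≡⟨ +-assoc σ (t * σ) _ ⟩
    σ + (t * σ + prefixSum f a)
      ≤⟨ +-mono-≤ (σ≤f _ (s≤s (m≤n+m a t)) ≤-refl)
                  (prefixSum-lower f a t (λ y a<y y≤ → σ≤f y a<y (m≤n⇒m≤1+n y≤))) ⟩
    f (suc (t + a)) + prefixSum f (t + a) ∎
  where open ≤-Reasoning

suffixMax : (ℕ → ℕ) → ℕ → ℕ → ℕ
suffixMax f j zero    = f j
suffixMax f j (suc t) = f j ⊔ suffixMax f (suc j) t

≤-suffixMax : ∀ f j {i t} → i ≤ t → f (i + j) ≤ suffixMax f j t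
≤-suffixMax f j {zero}  {zero}  _         = ≤-refl
≤-suffixMax f j {zero}  {suc t} _         = m≤m⊔n (f j) _
≤-suffixMax f j {suc i} {suc t} (s≤s i≤t) = begin
    f (suc i + j)          ≡⟨ cong f (+-suc i j) ⟨
    f (i + suc j)          ≤⟨ ≤-suffixMax f (suc j) i≤t ⟩
    suffixMax f (suc j) t  ≤⟨ m≤n⊔m (f j) _ ⟩
    suffixMax f j (suc t)  ∎
  where open ≤-Reasoning

upperEnvelope : ℕ → (ℕ → ℕ) → ℕ → ℕ
upperEnvelope N f j = suffixMax f j (N ∸ j)

≤-upperEnvelope : ∀ N f {j} → j ≤ N → f j ≤ upperEnvelope N f j
≤-upperEnvelope N f {j} _ = ≤-suffixMax f j {t = N ∸ j} z≤n

upperEnvelope-antitone : ∀ N f {i j} → i ≤ j → j ≤ N → upperEnvelope N f j ≤ upperEnvelope N f i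
upperEnvelope-antitone N f i≤j = go (≤⇒≤′ i≤j)
  where
  go : ∀ {i j} → i ≤′ j → j ≤ N → upperEnvelope N f j ≤ upperEnvelope N f i
  go ≤′-refl _ = ≤-refl
  go {i} {suc j} (≤′-step i≤′j) 1+j≤N = begin
      suffixMax f (suc j) (N ∸ suc j)        ≤⟨ m≤n⊔m (f j) _ ⟩
      suffixMax f j (suc (N ∸ suc j))        ≡⟨ cong (suffixMax f j) (+-∸-assoc 1 1+j≤N) ⟨
      upperEnvelope N f j                    ≤⟨ go i≤′j (≤-trans (n≤1+n j) 1+j≤N) ⟩
      upperEnvelope N f i                    ∎
    where open ≤-Reasoning

requiredWeight : (ℕ → ℕ) → ℕ → ℕ → ℕ → ℕ
requiredWeight g D M zero    = 0
requiredWeight g D M (suc j) = ⌈ (M ∸ D * g (suc j)) / suc j ⌉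

weights : ℕ → (ℕ → ℕ) → ℕ → ℕ → ℕ → ℕ
weights N g D M = upperEnvelope N (requiredWeight g D M)

weights-pay : ∀ N g D M {j} → 1 ≤ j → j ≤ N → M ≤ D * g j + j * weights N g D M j
weights-pay N g D M {suc j} _ j≤N = begin
    M                                   ≤⟨ m≤n+m∸n M a ⟩
    a + (M ∸ a)                         ≤⟨ +-monoʳ-≤ a (m≤⌈m/n⌉*n (M ∸ a)) ⟩
    a + w * suc j                       ≡⟨ cong (a +_) (*-comm w (suc j)) ⟩
    a + suc j * w                       ≤⟨ +-monoʳ-≤ a (*-monoʳ-≤ (suc j) w≤weight) ⟩
    a + suc j * weights N g D M (suc j) ∎
  where
  open ≤-Reasoning
  a = D * g (suc j)
  w = requiredWeight g D M (suc j)
  w≤weight : w ≤ weights N g D M (suc j)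
  w≤weight = ≤-upperEnvelope N (requiredWeight g D M) j≤N

Budget : ℕ → (ℕ → ℕ) → ℕ → ℕ → ℕ → Set
Budget N s D M L = prefixSum s N + D * L ≤ M + prefixSum s L

Budget-interpolation : ∀ {N s D M L t m} → Budget N s D M L → Budget N s D M (suc L) → t ≤ m →
  m * prefixSum s N + D * (t + L * m) ≤ M * m + (t * s (suc L) + m * prefixSum s L)
Budget-interpolation {N} {s} {D} {M} {L} {t} {m} b₀ b₁ t≤m =
  subst (λ m → m * P N + D * (t + L * m) ≤ M * m + (t * s (suc L) + m * P L))
        (m+[n∸m]≡n t≤m) (combination (m ∸ t))
  where
  P = prefixSum s
  open ≤-Reasoning
  combination : ∀ u → (t + u) * P N + D * (t + L * (t + u))
                      ≤ M * (t + u) + (t * s (suc L) + (t + u) * P L)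
  combination u = begin
      (t + u) * P N + D * (t + L * (t + u))          ≡⟨ lhs t u (P N) D L ⟩
      t * (P N + D * suc L) + u * (P N + D * L)      ≤⟨ +-mono-≤ (*-monoʳ-≤ t b₁) (*-monoʳ-≤ u b₀) ⟩
      t * (M + (s (suc L) + P L)) + u * (M + P L)    ≡⟨ rhs t u M (s (suc L)) (P L) ⟩
      M * (t + u) + (t * s (suc L) + (t + u) * P L)  ∎
    where
    lhs : ∀ t u a D L → (t + u) * a + D * (t + L * (t + u)) ≡ t * (a + D * suc L) + u * (a + D * L)
    lhs = solve-∀
    rhs : ∀ t u M σ b → t * (M + (σ + b)) + u * (M + b) ≡ M * (t + u) + (t * σ + (t + u) * b)
    rhs = solve-∀

bag : (p q : ℕ) → .{{NonZero q}} → ℕ → ℕ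
bag p q z = z * p / q

bonus : (p q : ℕ) → .{{NonZero q}} → ℕ → ℕ
bonus p q z = bag p q z ∸ z

bag≡id+bonus : ∀ {p q} .{{_ : NonZero q}} → q ≤ p → ∀ z → bag p q z ≡ z + bonus p q z
bag≡id+bonus {p} {q} q≤p z = sym (m+[n∸m]≡n z≤bag)
  where
  open ≤-Reasoning
  z≤bag : z ≤ bag p q z
  z≤bag = begin
    z          ≡⟨ m*n/n≡m z q ⟨
    z * q / q  ≤⟨ /-monoˡ-≤ q (*-monoʳ-≤ z q≤p) ⟩
    z * p / q  ∎

module Bricks (m p q : ℕ) .{{_ : NonZero m}} .{{_ : NonZero q}} where

  cost : ℕ → ℕ
  cost c = ⌈ c / m ⌉

  remainder : ℕ → ℕ → ℕ
  remainder c zero    = c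
  remainder c (suc k) = remainder (c ∸ cost c) k

  bonusSum : ℕ → ℕ → ℕ
  bonusSum c zero    = 0
  bonusSum c (suc k) = bonus p q (cost c) + bonusSum (c ∸ cost c) k

  cost+rest≡ : ∀ c → cost c + (c ∸ cost c) ≡ c
  cost+rest≡ c = m+[n∸m]≡n (⌈m/n⌉≤m c)

  remainder-≤ : ∀ c k → remainder c k ≤ c
  remainder-≤ c zero    = ≤-refl
  remainder-≤ c (suc k) = ≤-trans (remainder-≤ (c ∸ cost c) k) (m∸n≤m c (cost c))

  sum-bricksFrom : q ≤ p → ∀ c k → sum (bricksFrom m p q c k) + remainder c k ≡ c + bonusSum c k
  sum-bricksFrom q≤p c zero    = +-comm 0 c
  sum-bricksFrom q≤p c (suc k) = begin
      (bag p q z + sum (bricksFrom m p q c' k)) + remainder c' k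
        ≡⟨ +-assoc (bag p q z) _ _ ⟩
      bag p q z + (sum (bricksFrom m p q c' k) + remainder c' k)
        ≡⟨ cong₂ _+_ (bag≡id+bonus q≤p z) (sum-bricksFrom q≤p c' k) ⟩
      (z + bonus p q z) + (c' + bonusSum c' k)
        ≡⟨ shuffle z (bonus p q z) c' (bonusSum c' k) ⟩
      (z + c') + (bonus p q z + bonusSum c' k)
        ≡⟨ cong (_+ bonusSum c (suc k)) (cost+rest≡ c) ⟩
      c + bonusSum c (suc k) ∎
    where
    open ≡-Reasoning
    z = cost c
    c' = c ∸ z
    shuffle : ∀ a b x y → (a + b) + (x + y) ≡ (a + x) + (b + y)
    shuffle = solve-∀

  covers : q ≤ p → ∀ c k → remainder c k ≤ bonusSum c k → c ≤ sum (bricksFrom m p q c k)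
  covers q≤p c k r≤b = +-cancelʳ-≤ (remainder c k) c _ (begin
      c + remainder c k                          ≤⟨ +-monoʳ-≤ c r≤b ⟩
      c + bonusSum c k                           ≡⟨ sum-bricksFrom q≤p c k ⟨
      sum (bricksFrom m p q c k) + remainder c k ∎)
    where open ≤-Reasoning

  module Potential (s : ℕ → ℕ) where

    Φ : ℕ → ℕ
    Φ = prefixSum (s ∘ cost)

    Φ-partialBlock : ∀ k {t} → t ≤ m → Φ (t + k * m) ≡ t * s (suc k) + Φ (k * m)
    Φ-partialBlock k {t} t≤m = prefixSum-constant (s ∘ cost) (k * m) t
      λ y lo hi → cong s (o*n<m≤[1+o]*n⇒⌈m/n⌉≡1+o lo (≤-trans hi (+-monoˡ-≤ (k * m) t≤m)))

    Φ-blocks : ∀ k → Φ (k * m) ≡ m * prefixSum s k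
    Φ-blocks zero    = sym (*-zeroʳ m)
    Φ-blocks (suc k) = begin
        Φ (m + k * m)                          ≡⟨ Φ-partialBlock k ≤-refl ⟩
        m * s (suc k) + Φ (k * m)              ≡⟨ cong (m * s (suc k) +_) (Φ-blocks k) ⟩
        m * s (suc k) + m * prefixSum s k      ≡⟨ *-distribˡ-+ m (s (suc k)) _ ⟨
        m * prefixSum s (suc k)                ∎
      where open ≡-Reasoning

    module Descent (N D M : ℕ)
      (antitone : ∀ {i j} → i ≤ j → j ≤ N → s j ≤ s i)
      (pay : ∀ {z} → 1 ≤ z → z ≤ N → M ≤ D * bonus p q z + z * s z) where

      descent-step : ∀ c → 0 < c → c ≤ N * m →
                     M + Φ (c ∸ cost c) ≤ D * bonus p q (cost c) + Φ c
      descent-step c 0<c c≤Nm = begin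
          M + Φ c'                                ≤⟨ +-monoˡ-≤ (Φ c') (pay 1≤z z≤N) ⟩
          D * bonus p q z + z * s z + Φ c'        ≡⟨ +-assoc (D * bonus p q z) _ _ ⟩
          D * bonus p q z + (z * s z + Φ c')      ≤⟨ +-monoʳ-≤ (D * bonus p q z) drop ⟩
          D * bonus p q z + Φ c                   ∎
        where
        open ≤-Reasoning
        z = cost c
        c' = c ∸ z
        1≤z : 1 ≤ z
        1≤z = m*n<o⇒m<⌈o/n⌉ 0<c
        z≤N : z ≤ N
        z≤N = m≤o*n⇒⌈m/n⌉≤o c≤Nm
        drop : z * s z + Φ c' ≤ Φ c
        drop = subst (λ x → z * s z + Φ c' ≤ Φ x) (cost+rest≡ c)
          (prefixSum-lower (s ∘ cost) c' z
            (λ y _ y≤ → antitone (⌈/⌉-monoˡ-≤ (subst (y ≤_) (cost+rest≡ c) y≤)) z≤N))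

      descent : ∀ k c → c ≤ N * m → 0 < remainder c k →
                M * k + Φ (remainder c k) ≤ D * bonusSum c k + Φ c
      descent zero    c _ _ = ≤-reflexive (cong (_+ Φ c) (trans (*-zeroʳ M) (sym (*-zeroʳ D))))
      descent (suc k) c c≤Nm 0<r = begin
          M * suc k + Φ (remainder c' k)              ≡⟨ cong (_+ Φ (remainder c' k)) (*-suc M k) ⟩
          (M + M * k) + Φ (remainder c' k)            ≤⟨ +-telescope-≤ {a = M * k} {b} {M} {D * bonus p q z}
                                                                       (descent k c' c'≤Nm 0<r)
                                                                       (descent-step c 0<c c≤Nm) ⟩
          (D * bonus p q z + b) + Φ c                 ≡⟨ cong (_+ Φ c) (*-distribˡ-+ D _ _) ⟨
          D * bonusSum c (suc k) + Φ c                ∎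
        where
        open ≤-Reasoning
        z = cost c
        c' = c ∸ z
        b = D * bonusSum c' k
        c'≤Nm = ≤-trans (m∸n≤m c z) c≤Nm
        0<c = <-≤-trans 0<r (≤-trans (remainder-≤ c' k) (m∸n≤m c z))

  module Certificate (N D M : ℕ) where

    s : ℕ → ℕ
    s = weights N (bonus p q) D M

    open Potential s
    open Descent N D M (upperEnvelope-antitone N _) (weights-pay N (bonus p q) D M)

    remainder≤bonusSum : ∀ L {n t} → 1 ≤ D → Budget N s D M L → Budget N s D M (suc L) →
      n ≤ N * m → 0 < t → t ≤ m → remainder n m ≡ t + L * m → remainder n m ≤ bonusSum n m
    remainder≤bonusSum L {n} {t} 1≤D b₀ b₁ n≤Nm 0<t t≤m r≡ =
      *-cancelˡ-≤ D {{>-nonZero 1≤D}} (+-cancelʳ-≤ (m * P N) _ _ (begin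
        D * r + m * P N                        ≡⟨ +-comm (D * r) _ ⟩
        m * P N + D * r                        ≡⟨ cong (λ x → m * P N + D * x) r≡ ⟩
        m * P N + D * (t + L * m)              ≤⟨ Budget-interpolation {N} {s} {D} {M} {L} b₀ b₁ t≤m ⟩
        M * m + (t * s (suc L) + m * P L)      ≡⟨ cong (M * m +_) Φr≡ ⟨
        M * m + Φ r                            ≤⟨ descent m n n≤Nm 0<r ⟩
        D * B + Φ n                            ≤⟨ +-monoʳ-≤ (D * B) (prefixSum-mono-≤ _ n≤Nm) ⟩
        D * B + Φ (N * m)                      ≡⟨ cong (D * B +_) (Φ-blocks N) ⟩
        D * B + m * P N                        ∎))
      where
      open ≤-Reasoning
      P = prefixSum s
      r = remainder n m
      B = bonusSum n m
      Φr≡ : Φ r ≡ t * s (suc L) + m * P L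
      Φr≡ = trans (cong Φ r≡) (trans (Φ-partialBlock L t≤m) (cong (t * s (suc L) +_) (Φ-blocks L)))
      0<r : 0 < r
      0<r = subst (0 <_) (sym r≡) (≤-trans 0<t (m≤m+n t _))

Certified : ℕ → ℕ × ℕ → Set
Certified L (D , M) = 1 ≤ D × Budget 60 s D M L × Budget 60 s D M (suc L)
  where s = weights 60 (bonus 8 5) D M

certified? : ∀ L DM → Dec (Certified L DM)
certified? L (D , M) = 1 ≤? D ×-dec _ ≤? _ ×-dec _ ≤? _

-- Entry L holds the multipliers (D , M) used when the final remainder r satisfies ⌈r / m⌉ = L + 1.
levels : Vec (ℕ × ℕ) 60
levels =
  (1 , 1) ∷ (3 , 9) ∷ (4 , 16) ∷ (6 , 36) ∷ (9 , 63) ∷ (11 , 99) ∷ (12 , 120) ∷ (14 , 168) ∷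
  (14 , 182) ∷ (14 , 224) ∷ (18 , 306) ∷ (14 , 266) ∷ (15 , 300) ∷ (16 , 336) ∷ (18 , 414) ∷
  (18 , 468) ∷ (18 , 468) ∷ (18 , 504) ∷ (20 , 560) ∷ (20 , 600) ∷ (21 , 651) ∷ (20 , 700) ∷
  (14 , 952) ∷ (6 , 432) ∷ (4 , 280) ∷ (3 , 216) ∷ (2 , 156) ∷ (2 , 144) ∷ (2 , 140) ∷
  (2 , 134) ∷ (1 , 78) ∷ (1 , 75) ∷ (1 , 72) ∷ (1 , 70) ∷ (1 , 67) ∷ (1 , 64) ∷ (1 , 62) ∷
  (1 , 60) ∷ (1 , 60) ∷ (1 , 60) ∷ (1 , 60) ∷ (1 , 60) ∷ (1 , 60) ∷ (1 , 60) ∷ (1 , 60) ∷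
  (1 , 60) ∷ (1 , 60) ∷ (1 , 60) ∷ (1 , 60) ∷ (1 , 60) ∷ (1 , 60) ∷ (1 , 60) ∷ (1 , 60) ∷
  (1 , 60) ∷ (1 , 60) ∷ (1 , 60) ∷ (1 , 60) ∷ (1 , 60) ∷ (1 , 60) ∷ (1 , 60) ∷ []

levels-certified : ∀ i → Certified (toℕ i) (lookup levels i)
levels-certified = toWitness {a? = all? λ i → certified? (toℕ i) (lookup levels i)} _

module _ (n m : ℕ) .{{_ : NonZero m}} (n≤60m : n ≤ 60 * m) where
  open Bricks m 8 5

  remainder≤bonusSum-60 : remainder n m ≤ bonusSum n m
  remainder≤bonusSum-60 with remainder n m in r≡
  ... | zero   = z≤n
  ... | suc r' = subst (_≤ bonusSum n m) r≡
      (remainder≤bonusSum L 1≤D b₀ b₁ n≤60m (s≤s z≤n) (m%n<n r' m)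
        (trans r≡ (cong suc (m≡m%n+[m/n]*n r' m))))
    where
    open ≤-Reasoning
    L = r' / m
    L<60 : L < 60
    L<60 = *-cancelʳ-< m L 60 (begin-strict
      L * m             ≤⟨ m≤n+m (L * m) (r' % m) ⟩
      r' % m + L * m    ≡⟨ m≡m%n+[m/n]*n r' m ⟨
      r'                <⟨ n<1+n r' ⟩
      suc r'            ≡⟨ r≡ ⟨
      remainder n m     ≤⟨ remainder-≤ n m ⟩
      n                 ≤⟨ n≤60m ⟩
      60 * m            ∎)
    i = fromℕ< L<60
    open Certificate 60 (proj₁ (lookup levels i)) (proj₂ (lookup levels i))
    certificate : Certified L (lookup levels i)
    certificate = subst (λ l → Certified l (lookup levels i)) (toℕ-fromℕ< L<60) (levels-certified i)
    1≤D = proj₁ certificate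
    b₀ = proj₁ (proj₂ certificate)
    b₁ = proj₂ (proj₂ certificate)

theorem14 : (n m : ℕ) → .{{_ : NonZero m}} → 1 ≤ n → n ≤ 60 * m →
            n ≤ sum (bricks n m m 8 5)
theorem14 n m _ n≤60m = Bricks.covers m 8 5 (m≤m+n 5 3) n m (remainder≤bonusSum-60 n m n≤60m)
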